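{- There is no function $f$ with $f(m)\in o(m)$ such that any of the penalties $\mathrm{Pen}(\mathcal{T}_{\mathrm{comp}}^{\mathrm{nodist}}/\mathcal{T}_{\mathrm{comp}}^{\mathrm{dist}})$, $\mathrm{Pen}(\mathcal{T}_{\mathrm{blind}}^{\mathrm{nodist}}/\mathcal{T}_{\mathrm{blind}}^{\mathrm{dist}})$ or $\mathrm{Pen}(\mathcal{T}_{\mathrm{blind}}^{\mathrm{nodist}}/\mathcal{T}_{\mathrm{comp}}^{\mathrm{dist}})$ is $O(f(m))$.
   Context: Treasure hunt in trees. A tree is a finite tree rooted at the starting node of a mobile agent; at each node of degree $\delta$ the incident edges carry port numbers $0,\dots,\delta-1$, assigned arbitrarily at each node. $h(T)$ is the depth of $T$. An instance is a pair $(T,d)$ with $T$ a tree and $1\le d\le h(T)$; a knowledge is a set of instances. For a tree $T^*$ and $1\le d^*\le h(T^*)$, let $P(T^*)$ be the set of trees obtained from $T^*$ by reassigning arbitrary port numbers at each node. Knowledge types (each ranging over all trees $T^*$ and admissible $d^*$): $\mathcal{T}_{\mathrm{comp}}^{\mathrm{dist}}$ consists of the sets $\{(T^*,d^*)\}$; $\mathcal{T}_{\mathrm{blind}}^{\mathrm{dist}}$ of the sets $\{(T,d^*):T\in P(T^*)\}$; $\mathcal{T}_{\mathrm{comp}}^{\mathrm{nodist}}$ of the sets $\{(T^*,d):1\le d\le h(T^*)\}$; $\mathcal{T}_{\mathrm{blind}}^{\mathrm{nodist}}$ of the sets $\{(T,d):T\in P(T^*),1\le d\le h(T^*)\}$.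 A deterministic algorithm given knowledge $K$ starts at the root; at each step it sees the port numbers at its current node, chooses one based on its history (initially $K$), traverses the edge and learns the entry port and degree of the new node. The cost $C_{\mathcal{A}}^K(T,d)$ is the number of edge traversals (including revisits) by $\mathcal{A}$ in $T$ until all nodes at distance exactly $d$ from the root are visited. With $B_m(K)=\{(T,d)\in K:d\le m\}$, the overhead is $\mathcal{O}_{\mathcal{A}}^K(m)=\max_{(T,d)\in B_m(K)}C_{\mathcal{A}}^K(T,d)/d$ if $B_m(K)\ne\emptyset$, else $0$. For knowledge types $\mathcal{T}_1\ll\mathcal{T}_2$ (every $K_1\in\mathcal{T}_1$ is contained in some $K_2\in\mathcal{T}_2$) and $f:\mathbb{N}\to\mathbb{N}$, $\mathrm{Pen}(\mathcal{T}_2/\mathcal{T}_1)$ is $O(f)$ if there exist a constant $c>0$ and a deterministic algorithm $\mathcal{A}_2$ such that for every deterministic algorithm $\mathcal{A}_1$, for all $K_2\in\mathcal{T}_2$ and all $m\ge1$: $\mathcal{O}_{\mathcal{A}_2}^{K_2}(m)\le c\cdot f(m)\cdot\max_{K_1\in\mathcal{T}_1,K_1\subseteq K_2}\mathcal{O}_{\mathcal{A}_1}^{K_1}(m)$. -}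

module Defs where

open import Data.Nat using (ℕ; zero; suc; _+_; _*_; _∸_; _≤_; _⊔_; _<ᵇ_; _≡ᵇ_; _≤ᵇ_)
open import Data.Bool using (Bool; true; false; if_then_else_)
open import Data.Fin using (Fin; toℕ)
open import Data.List using (List; []; _∷_; length; reverse)
open import Data.Maybe using (Maybe; just; nothing; maybe; Is-just)
open import Data.Product using (Σ; _×_; _,_; proj₁; proj₂)
open import Relation.Binary.PropositionalEquality using (_≡_)
open import Data.List.Membership.Propositional using (_∈_)
open import Data.List.Relation.Binary.Permutation.Homogeneous using (Permutation)

-- A non-root node  node cs u  has degree  suc (length cs).  Port  toℕ u
-- leads to its parent; the remaining ports, in increasing order, lead to
-- the children  cs  in list order.  The root  root cs  has degree
-- length cs and port i leads to the i-th child.  Every port-labelled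
-- rooted tree is represented by exactly one such term (the children of
-- a node are listed in the order of their port numbers).

data PT : Set where
  node : (cs : List PT) → Fin (suc (length cs)) → PT

data Tree : Set where
  root : List PT → Tree

mutual
  depthPT : PT → ℕ
  depthPT (node cs _) = depthL cs

  depthL : List PT → ℕ
  depthL [] = 0
  depthL (c ∷ cs) = suc (depthPT c) ⊔ depthL cs

height : Tree → ℕ
height (root cs) = depthL cs

-- Positions: a node is addressed by its path of child indices from the
-- root, stored in reverse (head = last step).  Its distance from the
-- root is the length of the path.

Pos : Set
Pos = List ℕ

nth : {A : Set} → ℕ → List A → Maybe A
nth _ [] = nothing
nth zero (x ∷ _) = just x
nth (suc i) (_ ∷ xs) = nth i xs

mutual
  subAt : PT → List ℕ → Maybe PT
  subAt t [] = just t
  subAt (node cs _) (i ∷ is) = subAtL cs i is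

  subAtL : List PT → ℕ → List ℕ → Maybe PT
  subAtL [] _ _ = nothing
  subAtL (c ∷ _) zero is = subAt c is
  subAtL (_ ∷ cs) (suc i) is = subAtL cs i is

data View : Set where
  rootV : List PT → View
  subV  : PT → View

viewFrom : List PT → List ℕ → Maybe View
viewFrom cs [] = just (rootV cs)
viewFrom cs (i ∷ is) = Data.Maybe.map subV (subAtL cs i is)

viewAt : Tree → Pos → Maybe View
viewAt (root cs) π = viewFrom cs (reverse π)

IsNode : Tree → Pos → Set
IsNode T π = Is-just (viewAt T π)

degree : View → ℕ
degree (rootV cs) = length cs
degree (subV (node cs _)) = suc (length cs)

degAt : Tree → Pos → ℕ
degAt T π = maybe degree 0 (viewAt T π)

upPort : PT → ℕ
upPort (node _ u) = toℕ u

portToChild : View → ℕ → ℕ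
portToChild (rootV _) i = i
portToChild (subV (node _ u)) i = if i <ᵇ toℕ u then i else suc i

childMove : List PT → Pos → ℕ → Maybe (Pos × ℕ)
childMove cs π j with nth j cs
... | nothing = nothing
... | just c = just (j ∷ π , upPort c)

parentMove : Tree → Pos → Maybe (Pos × ℕ)
parentMove T [] = nothing
parentMove T (i ∷ rest) with viewAt T rest
... | nothing = nothing
... | just v = just (rest , portToChild v i)

-- traversing port p from position π: new position and entry port
-- (nothing if p is not a port of the current node)
move : Tree → Pos → ℕ → Maybe (Pos × ℕ)
move T π p with viewAt T π
... | nothing = nothing
... | just (rootV cs) = childMove cs π p
... | just (subV (node cs u)) =
  if p ≡ᵇ toℕ u then parentMove T π
  else if p <ᵇ toℕ u then childMove cs π p
  else if p ≤ᵇ length cs then childMove cs π (p ∸ 1)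
  else nothing

-- History: the degree of the root together with the list (most recent
-- first) of steps (port taken, entry port, degree of reached node).  Choosing a
-- number that is not a port of the current node means the agent stops
-- (it then never moves again).

History : Set
History = ℕ × List (ℕ × ℕ × ℕ)

Strategy : Set
Strategy = History → ℕ

-- configuration: current position, history, visited positions
Config : Set
Config = Pos × History × List Pos

initConfig : Tree → Config
initConfig T = [] , (degAt T [] , []) , ([] ∷ [])

step : Strategy → Tree → Config → Config
step s T (π , h , vis) with move T π (s h)
... | nothing = π , h , vis
... | just (π' , e) = π' , (proj₁ h , (s h , e , degAt T π') ∷ proj₂ h) , (π' ∷ vis)

runFor : Strategy → Tree → ℕ → Config
runFor s T zero = initConfig T
runFor s T (suc n) = step s T (runFor s T n)

visited : Config → List Pos
visited (_ , _ , vis) = vis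

-- CostLe s T d n :  C(T,d) ≤ n, i.e. within n edge traversals all nodes
-- at distance exactly d from the root have been visited.
CostLe : Strategy → Tree → ℕ → ℕ → Set
CostLe s T d n = ∀ π → IsNode T π → length π ≡ d → π ∈ visited (runFor s T n)

Instance : Set
Instance = Tree × ℕ

Knowledge : Set₁
Knowledge = Instance → Set

-- T ∈ P(T*) : T is obtained from T* by reassigning port numbers
data SamePT : PT → PT → Set where
  node : ∀ {cs cs' u u'} → Permutation SamePT cs cs' → SamePT (node cs u) (node cs' u')

InP : Tree → Tree → Set
InP (root cs) (root cs') = Permutation SamePT cs cs'

record KType : Set₁ where
  field
    Index : Set
    Kn    : Index → Knowledge
open KType public

Admissible : Tree → ℕ → Set
Admissible T d = 1 ≤ d × d ≤ height T

compDist : KType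
compDist = record
  { Index = Σ Instance (λ x → Admissible (proj₁ x) (proj₂ x))
  ; Kn = λ i x → proj₁ x ≡ proj₁ (proj₁ i) × proj₂ x ≡ proj₂ (proj₁ i) }

blindDist : KType
blindDist = record
  { Index = Σ Instance (λ x → Admissible (proj₁ x) (proj₂ x))
  ; Kn = λ i x → InP (proj₁ (proj₁ i)) (proj₁ x) × proj₂ x ≡ proj₂ (proj₁ i) }

compNodist : KType
compNodist = record
  { Index = Tree
  ; Kn = λ T* x → proj₁ x ≡ T* × Admissible T* (proj₂ x) }

blindNodist : KType
blindNodist = record
  { Index = Tree
  ; Kn = λ T* x → InP T* (proj₁ x) × Admissible T* (proj₂ x) }

_⊆K_ : Knowledge → Knowledge → Set
K₁ ⊆K K₂ = ∀ x → K₁ x → K₂ x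

_≐K_ : Knowledge → Knowledge → Set
K₁ ≐K K₂ = K₁ ⊆K K₂ × K₂ ⊆K K₁

-- A deterministic algorithm for knowledge type 𝒯: its behaviour depends
-- only on the knowledge (the set), not on the index describing it.
record Alg (𝒯 : KType) : Set where
  field
    strat : Index 𝒯 → Strategy
    inv   : ∀ i j → Kn 𝒯 i ≐K Kn 𝒯 j → ∀ h → strat i h ≡ strat j h
open Alg public

-- C₂ / d ≤ c·F·C₁ / d'   (costs possibly infinite; C₁ = ∞ makes it true)
RatioLe : Strategy → Tree → ℕ → ℕ → Strategy → Tree → ℕ → Set
RatioLe s₂ T d cF s₁ T' d' =
  ∀ n₁ → CostLe s₁ T' d' n₁ →
    Σ ℕ λ n₂ → CostLe s₂ T d n₂ × n₂ * d' ≤ cF * n₁ * d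

-- The inequality
--   O_{A₂}^{K₂}(m) ≤ c·f(m)·max_{K₁∈𝒯₁, K₁⊆K₂} O_{A₁}^{K₁}(m)
-- is unfolded: every (T,d) ∈ B_m(K₂) has C₂(T,d)/d bounded by c·f(m)
-- times C₁(T',d')/d' for some K₁ ⊆ K₂ in 𝒯₁ and (T',d') ∈ B_m(K₁)
-- (all these sets are finite, so the maxima are attained).
PenIsO : KType → KType → (ℕ → ℕ) → Set
PenIsO 𝒯₂ 𝒯₁ f =
  Σ ℕ λ c → 1 ≤ c × Σ (Alg 𝒯₂) λ A₂ →
    ∀ (A₁ : Alg 𝒯₁) (i₂ : Index 𝒯₂) (m : ℕ) → 1 ≤ m →
    ∀ T d → Kn 𝒯₂ i₂ (T , d) → d ≤ m →
    Σ (Index 𝒯₁) λ i₁ → (Kn 𝒯₁ i₁ ⊆K Kn 𝒯₂ i₂) ×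
      Σ Tree λ T' → Σ ℕ λ d' → Kn 𝒯₁ i₁ (T' , d') × d' ≤ m ×
        RatioLe (strat A₂ i₂) T d (c * f m) (strat A₁ i₁) T' d'

LittleO : (ℕ → ℕ) → Set
LittleO f = ∀ k → 1 ≤ k → Σ ℕ λ M → ∀ m → M ≤ m → k * f m ≤ m

module Submission where

open import Defs
open import Data.Nat using (ℕ)
open import Data.Sum using (_⊎_)
open import Relation.Nullary using (¬_)

open import Data.Bool using (Bool; true; false; if_then_else_; _∨_; _∧_; not; T)
open import Data.Bool.Properties using (∨-identityʳ; ∨-zeroʳ; ∧-zeroʳ)
open import Data.Empty using (⊥-elim)
open import Data.Fin using (toℕ) renaming (zero to fzero)
open import Data.Fin.Permutation using (↔⇒≡)
open import Data.List using (List; []; _∷_; length; reverse; _++_; _∷ʳ_; drop; replicate; applyUpTo)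
open import Data.List.Properties
  using (unfold-reverse; reverse-involutive; length-reverse; ++-assoc; length-++; length-applyUpTo; ∷-injectiveˡ)
open import Data.List.Membership.Propositional using (_∈_)
open import Data.List.Membership.Propositional.Properties using (∈-∃++; ∈-++⁻; ∈-++⁺ˡ; ∈-++⁺ʳ; ∈-applyUpTo⁻)
open import Data.List.Relation.Binary.Permutation.Homogeneous as ↭ using (Permutation)
open import Data.List.Relation.Binary.Pointwise using (Pointwise; []; _∷_)
open import Data.List.Relation.Binary.Subset.Propositional using (_⊆_)
open import Data.List.Relation.Unary.All using (All; []; _∷_; lookup)
open import Data.List.Relation.Unary.Any using (here; there)
open import Data.List.Relation.Unary.Unique.Propositional using (Unique; []; _∷_)
import Data.List.Relation.Unary.Unique.Propositional.Properties as Unique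
open import Data.Maybe using (Maybe; just; nothing; Is-just)
import Data.Maybe as Maybe
open import Data.Maybe.Relation.Unary.Any using (just)
open import Data.Nat
  using (zero; suc; _+_; _*_; _∸_; _≤_; _<_; _≤′_; _⊔_; _≡ᵇ_; _<ᵇ_; _≤ᵇ_; z≤n; s≤s; ≤′-refl; ≤′-step)
open import Data.Nat.GeneralisedArithmetic using (fold; fold-+)
open import Data.Nat.Properties
open import Data.Nat.Tactic.RingSolver using (solve-∀)
open import Data.Product using (Σ; _×_; _,_; proj₁; proj₂)
open import Data.Sum using (inj₁; inj₂)
open import Data.Unit using (⊤; tt)
open import Function using (id; _∘_)
open import Relation.Binary.PropositionalEquality
open import Relation.Nullary using (yes; no; contradiction)
open import Relation.Nullary.Decidable using (dec-true; dec-false)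

-- The witness is the caterpillar of length m: a path (the spine) whose node at depth j
-- carries a fan of j + 3 leaves.  Knowing d, a depth-first search that turns back at
-- depth d and never enters a fan whose leaves are not at depth d reaches depth d in at
-- most 8d steps, however the ports are labelled.  An algorithm ignorant of d that stayed
-- within a factor c·f(m) of this for every d ≤ m would visit all fan leaves of depth at
-- most m, about m²/2 positions, within 8·c·f(m)·m steps; counting visited positions
-- rules out 32·c·f(m) ≤ m for every m ≥ 3, whereas f ∈ o(m) guarantees it for large m.

≡ᵇ-refl : ∀ n → (n ≡ᵇ n) ≡ true
≡ᵇ-refl n = dec-true (n ≟ n) refl

≢⇒≡ᵇ-false : ∀ {m n} → m ≢ n → (m ≡ᵇ n) ≡ false
≢⇒≡ᵇ-false {m} {n} = dec-false (m ≟ n)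

<⇒<ᵇ-true : ∀ {m n} → m < n → (m <ᵇ n) ≡ true
<⇒<ᵇ-true {m} {n} = dec-true (m <? n)

≮⇒<ᵇ-false : ∀ {m n} → ¬ m < n → (m <ᵇ n) ≡ false
≮⇒<ᵇ-false {m} {n} = dec-false (m <? n)

≤⇒≤ᵇ-true : ∀ {m n} → m ≤ n → (m ≤ᵇ n) ≡ true
≤⇒≤ᵇ-true {m} {n} = dec-true (m ≤? n)

≰⇒≤ᵇ-false : ∀ {m n} → ¬ m ≤ n → (m ≤ᵇ n) ≡ false
≰⇒≤ᵇ-false {m} {n} = dec-false (m ≤? n)

Is-just-map⁻ : ∀ {A B : Set} {f : A → B} (x : Maybe A) → Is-just (Maybe.map f x) → Is-just x
Is-just-map⁻ (just _) _ = just tt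

nth⇒< : ∀ {A : Set} {k x} (xs : List A) → nth k xs ≡ just x → k < length xs
nth⇒< {k = zero} (_ ∷ _) _ = s≤s z≤n
nth⇒< {k = suc k} (_ ∷ xs) e = s≤s (nth⇒< xs e)

nth-replicate : ∀ {A : Set} {x : A} {ℓ} n → ℓ < n → nth ℓ (replicate n x) ≡ just x
nth-replicate {ℓ = zero} (suc n) _ = refl
nth-replicate {ℓ = suc ℓ} (suc n) (s≤s ℓ<n) = nth-replicate n ℓ<n

drop-∷⇒nth : ∀ {A : Set} {k x ys} (xs : List A) → drop k xs ≡ x ∷ ys → nth k xs ≡ just x
drop-∷⇒nth {k = zero} (_ ∷ _) refl = refl
drop-∷⇒nth {k = suc k} (_ ∷ xs) e = drop-∷⇒nth xs e

drop-∷⇒drop-suc : ∀ {A : Set} {k x ys} (xs : List A) → drop k xs ≡ x ∷ ys → drop (suc k) xs ≡ ys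
drop-∷⇒drop-suc {k = zero} (_ ∷ _) refl = refl
drop-∷⇒drop-suc {k = suc k} (_ ∷ xs) e = drop-∷⇒drop-suc xs e

drop-[]⇒≤ : ∀ {A : Set} {k} (xs : List A) → drop k xs ≡ [] → length xs ≤ k
drop-[]⇒≤ [] _ = z≤n
drop-[]⇒≤ {k = suc k} (_ ∷ xs) e = s≤s (drop-[]⇒≤ xs e)

reverse-∷-++ : ∀ {A : Set} (k : A) ρ π → reverse (k ∷ ρ) ++ π ≡ reverse ρ ++ (k ∷ π)
reverse-∷-++ k ρ π = trans (cong (_++ π) (unfold-reverse k ρ)) (++-assoc (reverse ρ) (k ∷ []) π)

Unique⇒length≤ : ∀ {A : Set} {xs ys : List A} → Unique xs → xs ⊆ ys → length xs ≤ length ys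
Unique⇒length≤ {xs = []} _ _ = z≤n
Unique⇒length≤ {xs = x ∷ xs} (x∉xs ∷ unique) xs⊆ys
  with ys₁ , ys₂ , refl ← ∈-∃++ (xs⊆ys (here refl)) = begin
  suc (length xs)                ≤⟨ s≤s (Unique⇒length≤ unique xs⊆ys₁ys₂) ⟩
  suc (length (ys₁ ++ ys₂))      ≡⟨ cong suc (length-++ ys₁) ⟩
  suc (length ys₁ + length ys₂)  ≡⟨ sym (+-suc (length ys₁) (length ys₂)) ⟩
  length ys₁ + length (x ∷ ys₂)  ≡⟨ sym (length-++ ys₁) ⟩
  length (ys₁ ++ x ∷ ys₂)        ∎
  where
    open ≤-Reasoning
    xs⊆ys₁ys₂ : xs ⊆ ys₁ ++ ys₂
    xs⊆ys₁ys₂ y∈xs with ∈-++⁻ ys₁ (xs⊆ys (there y∈xs))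
    ... | inj₁ y∈ys₁ = ∈-++⁺ˡ y∈ys₁
    ... | inj₂ (here refl) = ⊥-elim (lookup x∉xs y∈xs refl)
    ... | inj₂ (there y∈ys₂) = ∈-++⁺ʳ ys₁ y∈ys₂

children : View → List PT
children (rootV cs) = cs
children (subV (node cs _)) = cs

subAtL-[] : ∀ cs k → subAtL cs k [] ≡ nth k cs
subAtL-[] [] k = refl
subAtL-[] (c ∷ cs) zero = refl
subAtL-[] (c ∷ cs) (suc k) = subAtL-[] cs k

mutual
  subAt-∷ʳ : ∀ {x y c k} ρ → subAt x ρ ≡ just y → nth k (children (subV y)) ≡ just c →
             subAt x (ρ ∷ʳ k) ≡ just c
  subAt-∷ʳ {node cs _} [] refl hc = trans (subAtL-[] cs _) hc
  subAt-∷ʳ {node cs _} (i ∷ ρ) hy hc = subAtL-∷ʳ cs i ρ hy hc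

  subAtL-∷ʳ : ∀ {y c k} cs i ρ → subAtL cs i ρ ≡ just y → nth k (children (subV y)) ≡ just c →
              subAtL cs i (ρ ∷ʳ k) ≡ just c
  subAtL-∷ʳ (x ∷ cs) zero ρ hy hc = subAt-∷ʳ ρ hy hc
  subAtL-∷ʳ (x ∷ cs) (suc i) ρ hy hc = subAtL-∷ʳ cs i ρ hy hc

viewFrom-∷ʳ : ∀ {cs v c k} α → viewFrom cs α ≡ just v → nth k (children v) ≡ just c →
              viewFrom cs (α ∷ʳ k) ≡ just (subV c)
viewFrom-∷ʳ {cs} [] refl hc = cong (Maybe.map subV) (trans (subAtL-[] cs _) hc)
viewFrom-∷ʳ {cs} (i ∷ α) hv hc with subAtL cs i α in e
viewFrom-∷ʳ {cs} (i ∷ α) refl hc | just y = cong (Maybe.map subV) (subAtL-∷ʳ cs i α e hc)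

viewAt-∷ : ∀ {T π v c k} → viewAt T π ≡ just v → nth k (children v) ≡ just c →
           viewAt T (k ∷ π) ≡ just (subV c)
viewAt-∷ {root cs} {π} {k = k} hv hc =
  subst (λ α → viewFrom cs α ≡ just _) (sym (unfold-reverse k π)) (viewFrom-∷ʳ (reverse π) hv hc)

subAtL-child : ∀ cs k ρ → Is-just (subAtL cs k ρ) → Σ PT λ c → nth k cs ≡ just c × Is-just (subAt c ρ)
subAtL-child (c ∷ cs) zero ρ j = c , refl , j
subAtL-child (c ∷ cs) (suc k) ρ j = subAtL-child cs k ρ j

mutual
  subAt⇒≤depth : ∀ x ρ → Is-just (subAt x ρ) → length ρ ≤ depthPT x
  subAt⇒≤depth x [] _ = z≤n
  subAt⇒≤depth (node cs _) (i ∷ ρ) j = subAtL⇒<depth cs i ρ j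

  subAtL⇒<depth : ∀ cs i ρ → Is-just (subAtL cs i ρ) → length ρ < depthL cs
  subAtL⇒<depth (c ∷ cs) zero ρ j = m≤n⇒m≤n⊔o (depthL cs) (s≤s (subAt⇒≤depth c ρ j))
  subAtL⇒<depth (c ∷ cs) (suc i) ρ j = m≤n⇒m≤o⊔n (suc (depthPT c)) (subAtL⇒<depth cs i ρ j)

IsNode⇒≤height : ∀ {cs} π → IsNode (root cs) π → length π ≤ height (root cs)
IsNode⇒≤height {cs} π j = subst (_≤ depthL cs) (length-reverse π) (bound (reverse π) j)
  where
    bound : ∀ α → Is-just (viewFrom cs α) → length α ≤ depthL cs
    bound [] _ = z≤n
    bound (k ∷ ρ) j = subAtL⇒<depth cs k ρ (Is-just-map⁻ (subAtL cs k ρ) j)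

degAt-≡ : ∀ {T π v} → viewAt T π ≡ just v → degAt T π ≡ degree v
degAt-≡ hv rewrite hv = refl

-- childPort (toℕ u) is portToChild at a non-root node with parent port toℕ u; childIndex inverts it.
childPort : ℕ → ℕ → ℕ
childPort t k = if k <ᵇ t then k else suc k

childIndex : ℕ → ℕ → ℕ
childIndex t p = if p <ᵇ t then p else p ∸ 1

childPort≢ : ∀ t k → childPort t k ≢ t
childPort≢ t k with k <? t
... | yes k<t rewrite <⇒<ᵇ-true k<t = <⇒≢ k<t
... | no k≮t rewrite ≮⇒<ᵇ-false k≮t = λ k+1≡t → k≮t (≤-reflexive k+1≡t)

childIndex-childPort : ∀ t k → childIndex t (childPort t k) ≡ k
childIndex-childPort t k with k <? t
... | yes k<t rewrite <⇒<ᵇ-true k<t | <⇒<ᵇ-true k<t = refl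
... | no k≮t rewrite ≮⇒<ᵇ-false k≮t | ≮⇒<ᵇ-false (λ k+1<t → k≮t (<-trans (n<1+n k) k+1<t)) = refl

move-down : ∀ {T π v c k} → viewAt T π ≡ just v → nth k (children v) ≡ just c →
            move T π (portToChild v k) ≡ just (k ∷ π , upPort c)
move-down {v = rootV cs} hv hc rewrite hv | hc = refl
move-down {v = subV (node cs u)} {k = k} hv hc
  rewrite hv | ≢⇒≡ᵇ-false (childPort≢ (toℕ u) k) with k <? toℕ u
... | yes k<u rewrite <⇒<ᵇ-true k<u | <⇒<ᵇ-true k<u | hc = refl
... | no k≮u rewrite ≮⇒<ᵇ-false k≮u
                   | ≮⇒<ᵇ-false {suc k} {toℕ u} (λ k+1<u → k≮u (<-trans (n<1+n k) k+1<u))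
                   | ≤⇒≤ᵇ-true (nth⇒< cs hc) | hc = refl

move-up : ∀ {T i π v cs u} → viewAt T (i ∷ π) ≡ just (subV (node cs u)) → viewAt T π ≡ just v →
          move T (i ∷ π) (toℕ u) ≡ just (π , portToChild v i)
move-up {u = u} hx hv rewrite hx | ≡ᵇ-refl (toℕ u) | hv = refl

-- A pruned depth-first search

-- From its history the agent rebuilds the stack of ports leading back to the root:
-- a step through the port on top of the stack went up, any other step went down.
updateStack : List ℕ → ℕ → ℕ → List ℕ
updateStack [] p e = e ∷ []
updateStack (t ∷ ts) p e = if p ≡ᵇ t then ts else e ∷ t ∷ ts

stackOf : List (ℕ × ℕ × ℕ) → List ℕ
stackOf [] = []
stackOf ((p , e , _) ∷ steps) = updateStack (stackOf steps) p e

nextChildAfter : List ℕ → ℕ → ℕ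
nextChildAfter [] e = suc e
nextChildAfter (t ∷ _) e = if e ≡ᵇ t then 0 else suc (childIndex t e)

pendingChild : History → ℕ
pendingChild (_ , []) = 0
pendingChild (_ , steps@((_ , e , _) ∷ _)) = nextChildAfter (stackOf steps) e

currentDegree : History → ℕ
currentDegree (δ , []) = δ
currentDegree (_ , (_ , _ , δ) ∷ _) = δ

-- Spine nodes of the caterpillar have degree 3 and fan nodes degree > 3, so the
-- search enters a fan only when the fan's leaves are at depth d.
turnsBack : ℕ → ℕ → ℕ → Bool
turnsBack d j δ = (j ≡ᵇ d) ∨ ((3 <ᵇ δ) ∧ not (suc j ≡ᵇ d))

-- At the root the port of child k is k; once k reaches the degree, that port does not exist
-- and the agent stops.
choosePort : ℕ → List ℕ → ℕ → ℕ → ℕ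
choosePort d [] k δ = k
choosePort d (t ∷ ts) k δ = if turnsBack d (suc (length ts)) δ ∨ (δ ≤ᵇ suc k) then t else childPort t k

dfs : ℕ → Strategy
dfs d h = choosePort d (stackOf (proj₂ h)) (pendingChild h) (currentDegree h)

history : Config → History
history (_ , h , _) = h

data Ready (T : Tree) (π : Pos) (ps : List ℕ) (k : ℕ) : Config → Set where
  ready : ∀ {h W} → stackOf (proj₂ h) ≡ ps → pendingChild h ≡ k → currentDegree h ≡ degAt T π → π ∈ W →
          Ready T π ps k (π , h , W)

data StackAt : View → List ℕ → Set where
  root : ∀ {cs} → StackAt (rootV cs) []
  sub  : ∀ {cs u ps} → StackAt (subV (node cs u)) (toℕ u ∷ ps)

Ready-init : ∀ T → Ready T [] [] 0 (initConfig T)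
Ready-init T = ready refl refl refl (here refl)

Ready⇒∈ : ∀ {T π ps k c} → Ready T π ps k c → π ∈ visited c
Ready⇒∈ (ready _ _ _ π∈W) = π∈W

dfs-Ready : ∀ {d T π ps k c} → Ready T π ps k c → dfs d (history c) ≡ choosePort d ps k (degAt T π)
dfs-Ready {d} {ps = ps} {k} (ready refl refl δ _) = cong (choosePort d ps k) δ

step-Ready : ∀ {s T π ps k c q π′ e ps′ k′} → Ready T π ps k c → s (history c) ≡ q →
             move T π q ≡ just (π′ , e) → updateStack ps q e ≡ ps′ → nextChildAfter ps′ e ≡ k′ →
             Ready T π′ ps′ k′ (step s T c) × visited c ⊆ visited (step s T c)
step-Ready (ready refl _ _ _) refl mv refl refl rewrite mv = ready refl refl refl (here refl) , there

updateStack-down : ∀ {v ps k e} → StackAt v ps → updateStack ps (portToChild v k) e ≡ e ∷ ps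
updateStack-down root = refl
updateStack-down {subV (node _ u)} {k = k} sub rewrite ≢⇒≡ᵇ-false (childPort≢ (toℕ u) k) = refl

updateStack-up : ∀ t ts e → updateStack (t ∷ ts) t e ≡ ts
updateStack-up t ts e rewrite ≡ᵇ-refl t = refl

nextChildAfter-down : ∀ t ts → nextChildAfter (t ∷ ts) t ≡ 0
nextChildAfter-down t ts rewrite ≡ᵇ-refl t = refl

nextChildAfter-up : ∀ {v ps k} → StackAt v ps → nextChildAfter ps (portToChild v k) ≡ suc k
nextChildAfter-up root = refl
nextChildAfter-up {subV (node _ u)} {k = k} sub
  rewrite ≢⇒≡ᵇ-false (childPort≢ (toℕ u) k) = cong suc (childIndex-childPort (toℕ u) k)

choosePort-enters : ∀ {d T i π cs u S k} → viewAt T (i ∷ π) ≡ just (subV (node cs u)) → length S ≡ length π →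
                    turnsBack d (suc (length π)) (suc (length cs)) ≡ false → k < length cs →
                    choosePort d (toℕ u ∷ S) k (degAt T (i ∷ π)) ≡ childPort (toℕ u) k
choosePort-enters {T = T} hx hS enter k<L
  rewrite degAt-≡ {T} hx | hS | enter | ≰⇒≤ᵇ-false (<⇒≱ (s≤s k<L)) = refl

ascend : ∀ {d T i π cs u v S k c} → viewAt T (i ∷ π) ≡ just (subV (node cs u)) → viewAt T π ≡ just v →
         StackAt v S → length S ≡ length π →
         turnsBack d (suc (length π)) (suc (length cs)) ≡ true ⊎ length cs ≤ k →
         Ready T (i ∷ π) (toℕ u ∷ S) k c →
         Ready T π S (suc i) (step (dfs d) T c) × visited c ⊆ visited (step (dfs d) T c)
ascend {d} {T} {i} {π} {cs} {u} {S = S} {k} hx hv sv hS leaves r =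
  step-Ready {s = dfs d} r (trans (dfs-Ready r) (choosePort-leaves leaves))
    (move-up {T} hx hv) (updateStack-up (toℕ u) S _) (nextChildAfter-up sv)
  where
    choosePort-leaves : turnsBack d (suc (length π)) (suc (length cs)) ≡ true ⊎ length cs ≤ k →
                        choosePort d (toℕ u ∷ S) k (degAt T (i ∷ π)) ≡ toℕ u
    choosePort-leaves (inj₁ back) rewrite degAt-≡ {T} hx | hS | back = refl
    choosePort-leaves (inj₂ L≤k) rewrite degAt-≡ {T} hx | hS | ≤⇒≤ᵇ-true (s≤s L≤k)
                                       | ∨-zeroʳ (turnsBack d (suc (length π)) (suc (length cs))) = refl

mutual
  tourCost : ℕ → ℕ → PT → ℕ
  tourCost d j (node cs _) = if turnsBack d j (suc (length cs)) then 1 else suc (toursCost d (suc j) cs)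

  toursCost : ℕ → ℕ → List PT → ℕ
  toursCost d j [] = 0
  toursCost d j (c ∷ cs) = suc (tourCost d j c) + toursCost d j cs

mutual
  Safe : ℕ → ℕ → PT → Set
  Safe d j (node cs _) =
    (turnsBack d j (suc (length cs)) ≡ true → j + depthL cs < d ⊎ d ≤ j) × AllSafe d (suc j) cs

  AllSafe : ℕ → ℕ → List PT → Set
  AllSafe d j [] = ⊤
  AllSafe d j (c ∷ cs) = Safe d j c × AllSafe d j cs

-- Positions are reversed paths: reverse ρ ++ π is reached from π along ρ.
Covered : ℕ → PT → Pos → List Pos → Set
Covered d x π W = ∀ ρ → Is-just (subAt x ρ) → length π + length ρ ≡ d → reverse ρ ++ π ∈ W

Covered-mono : ∀ {d x π W W′} → W ⊆ W′ → Covered d x π W → Covered d x π W′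
Covered-mono W⊆W′ cov ρ j len = W⊆W′ (cov ρ j len)

Covered-shallow : ∀ {d x π W} → π ∈ W → length π + depthPT x < d ⊎ d ≤ length π → Covered d x π W
Covered-shallow π∈W _ [] _ _ = π∈W
Covered-shallow {d} {x} {π} _ (inj₁ deep<d) (k ∷ ρ) j len =
  ⊥-elim (<-irrefl len (≤-<-trans (+-monoʳ-≤ (length π) (subAt⇒≤depth x (k ∷ ρ) j)) deep<d))
Covered-shallow {π = π} _ (inj₂ d≤π) (k ∷ ρ) j len =
  ⊥-elim (<-irrefl (sym len) (≤-<-trans d≤π (m<m+n (length π) (s≤s z≤n))))

Covered-node : ∀ {d cs u π W} → π ∈ W → (∀ {k c} → nth k cs ≡ just c → Covered d c (k ∷ π) W) →
               Covered d (node cs u) π W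
Covered-node π∈W _ [] _ _ = π∈W
Covered-node {d} {cs} {π = π} {W} _ below (k ∷ ρ) j len with subAtL-child cs k ρ j
... | c , hc , jc = subst (_∈ W) (sym (reverse-∷-++ k ρ π))
                      (below hc ρ jc (trans (sym (+-suc (length π) (length ρ))) len))

run : Strategy → Tree → ℕ → Config → Config
run s T n c = fold c (step s T) n

run-then : ∀ s T t r c → run s T (suc t + r) c ≡ run s T r (run s T t (step s T c))
run-then s T t r c = begin
  fold c f (suc t + r)         ≡⟨ cong (fold c f) (+-comm (suc t) r) ⟩
  fold c f (r + suc t)         ≡⟨ fold-+ c f r ⟩
  fold (fold c f (suc t)) f r  ≡⟨ cong (λ c′ → fold c′ f r)
                                         (trans (cong (fold c f) (+-comm 1 t)) (fold-+ c f t)) ⟩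
  fold (fold (f c) f t) f r    ∎
  where
    open ≡-Reasoning
    f = step s T

runFor≡run : ∀ s T n → runFor s T n ≡ run s T n (initConfig T)
runFor≡run s T zero = refl
runFor≡run s T (suc n) = cong (step s T) (runFor≡run s T n)

Returned : ℕ → Tree → PT → ℕ → Pos → List ℕ → Config → Config → Set
Returned d T x i π S c c′ =
  Ready T π S (suc i) c′ × visited c ⊆ visited c′ × Covered d x (i ∷ π) (visited c′)

Tour : ℕ → Tree → PT → Set
Tour d T x = ∀ {i π v S c} →
  viewAt T (i ∷ π) ≡ just (subV x) → viewAt T π ≡ just v → StackAt v S → length S ≡ length π →
  Safe d (suc (length π)) x → Ready T (i ∷ π) (upPort x ∷ S) 0 c →
  Returned d T x i π S c (run (dfs d) T (tourCost d (suc (length π)) x) c)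

module Children (d : ℕ) (T : Tree) {π : Pos} {v : View} {ps : List ℕ}
  (hv : viewAt T π ≡ just v) (stackAt : StackAt v ps) (hlen : length ps ≡ length π)
  (descends : ∀ {k} → k < length (children v) → choosePort d ps k (degAt T π) ≡ portToChild v k) where

  ChildrenCovered : ℕ → List Pos → Set
  ChildrenCovered k W = ∀ {k′ c} → k ≤ k′ → nth k′ (children v) ≡ just c → Covered d c (k′ ∷ π) W

  Explored : ℕ → Config → Config → Set
  Explored k c c′ = Σ ℕ λ k′ → length (children v) ≤ k′ × Ready T π ps k′ c′ ×
                    visited c ⊆ visited c′ × ChildrenCovered k (visited c′)

  extendCovered : ∀ {k c W} → nth k (children v) ≡ just c → Covered d c (k ∷ π) W →
                  ChildrenCovered (suc k) W → ChildrenCovered k W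
  extendCovered {k} hc cov rest {k′} k≤k′ hc′ with k ≟ k′
  ... | no k≢k′ = rest (≤∧≢⇒< k≤k′ k≢k′) hc′
  ... | yes refl with trans (sym hc) hc′
  ...   | refl = cov

  explore : ∀ {k c} ds → drop k (children v) ≡ ds → All (Tour d T) ds → AllSafe d (suc (length π)) ds →
            Ready T π ps k c → Explored k c (run (dfs d) T (toursCost d (suc (length π)) ds) c)
  explore {k} [] dk [] _ r =
    k , L≤k , r , id ,
    λ k≤k′ hc → ⊥-elim (<-irrefl refl (<-≤-trans (nth⇒< (children v) hc) (≤-trans L≤k k≤k′)))
    where
      L≤k : length (children v) ≤ k
      L≤k = drop-[]⇒≤ (children v) dk
  explore {k} {c} (x ∷ ds) dk (tour-x ∷ tours) (safe-x , safes) r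
    with hx ← drop-∷⇒nth (children v) dk
    with r₁ , c⊆c₁ ← step-Ready {s = dfs d} r (trans (dfs-Ready r) (descends (nth⇒< (children v) hx)))
                       (move-down {T} hv hx) (updateStack-down stackAt) (nextChildAfter-down (upPort x) ps)
    with r₂ , c₁⊆c₂ , cov-x ← tour-x (viewAt-∷ {T} hv hx) hv stackAt hlen safe-x r₁
    with k′ , L≤k′ , r₃ , c₂⊆c₃ , cov ← explore ds (drop-∷⇒drop-suc (children v) dk) tours safes r₂
    = subst (Explored k c)
        (sym (run-then (dfs d) T (tourCost d (suc (length π)) x) (toursCost d (suc (length π)) ds) c))
        (k′ , L≤k′ , r₃ , c₂⊆c₃ ∘ c₁⊆c₂ ∘ c⊆c₁ , extendCovered hx (Covered-mono c₂⊆c₃ cov-x) cov)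

nodeTour : ∀ {d T cs u} → All (Tour d T) cs → Tour d T (node cs u)
nodeTour {d} {T} {cs} {u} tours {i} {π} {v} {S} {c} hx hv sv hS (safe , safes) r
  with turnsBack d (suc (length π)) (suc (length cs)) in back
... | true
  with r′ , c⊆c′ ← ascend hx hv sv hS (inj₁ back) r
  = r′ , c⊆c′ , Covered-shallow (c⊆c′ (Ready⇒∈ r)) (safe refl)
... | false
  with k′ , L≤k′ , r₁ , c⊆c₁ , cov ← Children.explore d T hx sub (cong suc hS)
                                       (choosePort-enters {d} {T} {i} {π} {S = S} hx hS back)
                                       cs refl tours safes r
  with r′ , c₁⊆c′ ← ascend hx hv sv hS (inj₂ L≤k′) r₁
  = r′ , c₁⊆c′ ∘ c⊆c₁ ,
    Covered-node (c₁⊆c′ (c⊆c₁ (Ready⇒∈ r))) (λ hc → Covered-mono c₁⊆c′ (cov z≤n hc))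

mutual
  tour : ∀ d T x → Tour d T x
  tour d T (node cs u) = nodeTour (tours d T cs)

  tours : ∀ d T cs → All (Tour d T) cs
  tours d T [] = []
  tours d T (c ∷ cs) = tour d T c ∷ tours d T cs

dfs-reaches-depth : ∀ {d cs} → 1 ≤ d → AllSafe d 1 cs → CostLe (dfs d) (root cs) d (toursCost d 1 cs)
dfs-reaches-depth {d} {cs} d≥1 safes π isNode len
  rewrite runFor≡run (dfs d) (root cs) (toursCost d 1 cs)
  with _ , _ , _ , _ , cov ← Children.explore d (root cs) {π = []} refl root refl (λ _ → refl)
                               cs refl (tours d (root cs) cs) safes (Ready-init (root cs))
  with reverse π | length-reverse π | reverse-involutive π
... | [] | len-rev | _ = ⊥-elim (<-irrefl (trans len-rev len) d≥1)
... | k ∷ ρ | len-rev | rev-rev with subAtL-child cs k ρ (Is-just-map⁻ (subAtL cs k ρ) isNode)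
...   | c , hc , jc =
  subst (_∈ _) (trans (sym (unfold-reverse k ρ)) rev-rev) (cov z≤n hc ρ jc (trans len-rev len))

-- Invariance under relabelling

mutual
  SamePT-refl : ∀ x → SamePT x x
  SamePT-refl (node cs _) = node (↭.refl (Pointwise-SamePT-refl cs))

  Pointwise-SamePT-refl : ∀ cs → Pointwise SamePT cs cs
  Pointwise-SamePT-refl [] = []
  Pointwise-SamePT-refl (c ∷ cs) = SamePT-refl c ∷ Pointwise-SamePT-refl cs

InP-refl : ∀ T → InP T T
InP-refl (root cs) = ↭.refl (Pointwise-SamePT-refl cs)

↭-length : ∀ {cs cs′} → Permutation SamePT cs cs′ → length cs ≡ length cs′
↭-length p = ↔⇒≡ (↭.onIndices p)

mutual
  depthPT-≈ : ∀ {x y} → SamePT x y → depthPT x ≡ depthPT y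
  depthPT-≈ (node p) = depthL-↭ p

  depthL-↭ : ∀ {cs cs′} → Permutation SamePT cs cs′ → depthL cs ≡ depthL cs′
  depthL-↭ (↭.refl p) = depthL-pw p
  depthL-↭ (↭.prep e p) = cong₂ _⊔_ (cong suc (depthPT-≈ e)) (depthL-↭ p)
  depthL-↭ (↭.swap {xs} {x = x} {y} e₁ e₂ p) =
    trans (⊔-swap (suc (depthPT x)) (suc (depthPT y)) (depthL xs))
          (cong₂ _⊔_ (cong suc (depthPT-≈ e₂)) (cong₂ _⊔_ (cong suc (depthPT-≈ e₁)) (depthL-↭ p)))
    where
      ⊔-swap : ∀ a b n → a ⊔ (b ⊔ n) ≡ b ⊔ (a ⊔ n)
      ⊔-swap a b n = trans (sym (⊔-assoc a b n)) (trans (cong (_⊔ n) (⊔-comm a b)) (⊔-assoc b a n))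
  depthL-↭ (↭.trans p q) = trans (depthL-↭ p) (depthL-↭ q)

  depthL-pw : ∀ {cs cs′} → Pointwise SamePT cs cs′ → depthL cs ≡ depthL cs′
  depthL-pw [] = refl
  depthL-pw (e ∷ p) = cong₂ _⊔_ (cong suc (depthPT-≈ e)) (depthL-pw p)

mutual
  tourCost-≈ : ∀ d j {x y} → SamePT x y → tourCost d j x ≡ tourCost d j y
  tourCost-≈ d j (node p) rewrite ↭-length p | toursCost-↭ d (suc j) p = refl

  toursCost-↭ : ∀ d j {cs cs′} → Permutation SamePT cs cs′ → toursCost d j cs ≡ toursCost d j cs′
  toursCost-↭ d j (↭.refl p) = toursCost-pw d j p
  toursCost-↭ d j (↭.prep e p) = cong₂ _+_ (cong suc (tourCost-≈ d j e)) (toursCost-↭ d j p)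
  toursCost-↭ d j (↭.swap {xs} {x = x} {y} e₁ e₂ p) =
    trans (+-swap (suc (tourCost d j x)) (suc (tourCost d j y)) (toursCost d j xs))
          (cong₂ _+_ (cong suc (tourCost-≈ d j e₂))
                     (cong₂ _+_ (cong suc (tourCost-≈ d j e₁)) (toursCost-↭ d j p)))
    where
      +-swap : ∀ a b n → a + (b + n) ≡ b + (a + n)
      +-swap = solve-∀
  toursCost-↭ d j (↭.trans p q) = trans (toursCost-↭ d j p) (toursCost-↭ d j q)

  toursCost-pw : ∀ d j {cs cs′} → Pointwise SamePT cs cs′ → toursCost d j cs ≡ toursCost d j cs′
  toursCost-pw d j [] = refl
  toursCost-pw d j (e ∷ p) = cong₂ _+_ (cong suc (tourCost-≈ d j e)) (toursCost-pw d j p)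

mutual
  Safe-≈ : ∀ d j {x y} → SamePT x y → Safe d j x → Safe d j y
  Safe-≈ d j (node p) (shallow , safes) rewrite ↭-length p | depthL-↭ p = shallow , AllSafe-↭ d (suc j) p safes

  AllSafe-↭ : ∀ d j {cs cs′} → Permutation SamePT cs cs′ → AllSafe d j cs → AllSafe d j cs′
  AllSafe-↭ d j (↭.refl p) s = AllSafe-pw d j p s
  AllSafe-↭ d j (↭.prep e p) (a , s) = Safe-≈ d j e a , AllSafe-↭ d j p s
  AllSafe-↭ d j (↭.swap e₁ e₂ p) (a , b , s) = Safe-≈ d j e₂ b , Safe-≈ d j e₁ a , AllSafe-↭ d j p s
  AllSafe-↭ d j (↭.trans p q) s = AllSafe-↭ d j q (AllSafe-↭ d j p s)

  AllSafe-pw : ∀ d j {cs cs′} → Pointwise SamePT cs cs′ → AllSafe d j cs → AllSafe d j cs′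
  AllSafe-pw d j [] s = s
  AllSafe-pw d j (e ∷ p) (a , s) = Safe-≈ d j e a , AllSafe-pw d j p s

-- The caterpillar

leaf : PT
leaf = node [] fzero

fan : ℕ → PT
fan n = node (replicate n leaf) fzero

-- spine j r: the spine node at depth j, with r further spine nodes below it.
spine : ℕ → ℕ → PT
spine j zero = leaf
spine j (suc r) = node (fan (3 + j) ∷ spine (suc j) r ∷ []) fzero

caterpillar : ℕ → Tree
caterpillar m = root (spine 1 m ∷ [])

turnsBack-deg3 : ∀ {d j} → turnsBack d j 3 ≡ true → j ≡ d
turnsBack-deg3 {d} {j} back = ≡ᵇ⇒≡ j d (subst T (sym (trans (sym (∨-identityʳ (j ≡ᵇ d))) back)) tt)

turnsBack-above : ∀ {d j} δ → suc j ≡ d → turnsBack d j δ ≡ false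
turnsBack-above {d} {j} δ refl
  rewrite ≢⇒≡ᵇ-false {j} {suc j} (1+n≢n ∘ sym) | ≡ᵇ-refl (suc j) | ∧-zeroʳ (3 <ᵇ δ) = refl

turnsBack-fan : ∀ {d j} n → suc (suc j) ≢ d → turnsBack d (suc j) (4 + n) ≡ true
turnsBack-fan {d} {j} n j+2≢d rewrite ≢⇒≡ᵇ-false j+2≢d = ∨-zeroʳ (suc j ≡ᵇ d)

Safe-leaf : ∀ d j → Safe d j leaf
Safe-leaf d j = (λ _ → shallow) , tt
  where
    shallow : j + 0 < d ⊎ d ≤ j
    shallow with d ≤? j
    ... | yes d≤j = inj₂ d≤j
    ... | no d≰j = inj₁ (subst (_< d) (sym (+-identityʳ j)) (≰⇒> d≰j))

AllSafe-leaves : ∀ d j n → AllSafe d j (replicate n leaf)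
AllSafe-leaves d j zero = tt
AllSafe-leaves d j (suc n) = Safe-leaf d j , AllSafe-leaves d j n

depthL-leaves : ∀ n → depthL (replicate n leaf) ≤ 1
depthL-leaves zero = z≤n
depthL-leaves (suc n) = ⊔-lub ≤-refl (depthL-leaves n)

Safe-fan : ∀ d j n → Safe d j (fan n)
Safe-fan d j n = shallow , AllSafe-leaves d (suc j) n
  where
    shallow : turnsBack d j (suc (length (replicate n leaf))) ≡ true → j + depthL (replicate n leaf) < d ⊎ d ≤ j
    shallow back with d ≤? j | suc j ≟ d
    ... | yes d≤j | _ = inj₂ d≤j
    ... | no _ | yes j+1≡d =
      contradiction (trans (sym back) (turnsBack-above (suc (length (replicate n leaf))) j+1≡d)) λ ()
    ... | no d≰j | no j+1≢d =
      inj₁ (≤-<-trans (+-monoʳ-≤ j (depthL-leaves n)) (subst (_< d) (+-comm 1 j) (≤∧≢⇒< (≰⇒> d≰j) j+1≢d)))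

Safe-spine : ∀ d j r → Safe d j (spine j r)
Safe-spine d j zero = Safe-leaf d j
Safe-spine d j (suc r) =
  (λ back → inj₂ (≤-reflexive (sym (turnsBack-deg3 back)))) , Safe-fan d (suc j) (3 + j) , Safe-spine d (suc j) r , tt

tourCost-leaf : ∀ d j → tourCost d j leaf ≡ 1
tourCost-leaf d j with turnsBack d j 1
... | true = refl
... | false = refl

tourCost≤ : ∀ d j cs u → tourCost d j (node cs u) ≤ suc (toursCost d (suc j) cs)
tourCost≤ d j cs u with turnsBack d j (suc (length cs))
... | true = s≤s z≤n
... | false = ≤-refl

toursCost-leaves : ∀ d j n → toursCost d j (replicate n leaf) ≡ 2 * n
toursCost-leaves d j zero = refl
toursCost-leaves d j (suc n) rewrite tourCost-leaf d j | toursCost-leaves d j n = sym (*-suc 2 n)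

fanCost : ℕ → ℕ → ℕ
fanCost d j = tourCost d (suc j) (fan (3 + j))

fanCost-back : ∀ {d j} → suc (suc j) ≢ d → fanCost d j ≡ 1
fanCost-back {d} {j} j+2≢d rewrite turnsBack-fan {d} {j} (length (replicate j leaf)) j+2≢d = refl

fanCost≤ : ∀ d j → fanCost d j ≤ 2 * d + 3
fanCost≤ d j with suc (suc j) ≟ d
... | no j+2≢d = ≤-trans (≤-reflexive (fanCost-back j+2≢d)) (≤-trans (s≤s z≤n) (m≤n+m 3 (2 * d)))
... | yes refl = ≤-trans (tourCost≤ d (suc j) (replicate (3 + j) leaf) fzero)
                         (≤-reflexive (trans (cong suc (toursCost-leaves d (2 + j) (3 + j))) (arith j)))
  where
    arith : ∀ j → suc (2 * (3 + j)) ≡ 2 * (2 + j) + 3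
    arith = solve-∀

spineCost-step : ∀ {d j} r → j ≢ d →
                 tourCost d j (spine j (suc r)) ≡ 3 + (fanCost d j + tourCost d (suc j) (spine (suc j) r))
spineCost-step {d} {j} r j≢d rewrite ≢⇒≡ᵇ-false j≢d = arith (fanCost d j) (tourCost d (suc j) (spine (suc j) r))
  where
    arith : ∀ a b → suc (suc a + (suc b + 0)) ≡ 3 + (a + b)
    arith = solve-∀

spineCost-at : ∀ {d j} r → j ≡ d → tourCost d j (spine j r) ≡ 1
spineCost-at {d} {j} zero _ = tourCost-leaf d j
spineCost-at {d} {j} (suc r) j≡d rewrite dec-true (j ≟ d) j≡d = refl

spineCost-one : ∀ {d j} r → suc j ≡ d → tourCost d j (spine j r) ≤ 5
spineCost-one {d} {j} zero _ = ≤-trans (≤-reflexive (tourCost-leaf d j)) (s≤s z≤n)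
spineCost-one {d} {j} (suc r) refl = ≤-reflexive (begin
  tourCost d j (spine j (suc r))                           ≡⟨ spineCost-step r (1+n≢n ∘ sym) ⟩
  3 + (fanCost d j + tourCost d (suc j) (spine (suc j) r)) ≡⟨ cong₂ (λ a b → 3 + (a + b))
                                                                    (fanCost-back (1+n≢n {suc j})) (spineCost-at r refl) ⟩
  5                                                        ∎)
  where open ≡-Reasoning

spineCost-two : ∀ {d j} r → 2 + j ≡ d → tourCost d j (spine j r) ≤ 2 * d + 11
spineCost-two {d} {j} zero _ = ≤-trans (≤-reflexive (tourCost-leaf d j)) (≤-trans (s≤s z≤n) (m≤n+m 11 (2 * d)))
spineCost-two {d} {j} (suc r) refl = begin
  tourCost d j (spine j (suc r))                           ≡⟨ spineCost-step r (λ j≡j+2 →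
                                                                <-irrefl j≡j+2 (m≤n⇒m≤1+n (n<1+n j))) ⟩
  3 + (fanCost d j + tourCost d (suc j) (spine (suc j) r)) ≤⟨ +-monoʳ-≤ 3 (+-mono-≤ (fanCost≤ d j)
                                                                                     (spineCost-one r refl)) ⟩
  3 + (2 * d + 3 + 5)                                      ≡⟨ arith d ⟩
  2 * d + 11                                               ∎
  where
    open ≤-Reasoning
    arith : ∀ d → 3 + (2 * d + 3 + 5) ≡ 2 * d + 11
    arith = solve-∀

spineCost : ∀ {d j} k r → j + k ≡ d → tourCost d j (spine j r) ≤ 4 * k + 2 * d + 4
spineCost {d} {j} zero r j+0≡d =
  ≤-trans (≤-reflexive (spineCost-at r (trans (sym (+-identityʳ j)) j+0≡d))) (≤-trans (s≤s z≤n) (m≤n+m 4 (2 * d)))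
spineCost {d} {j} 1 r j+1≡d =
  ≤-trans (spineCost-one r (trans (+-comm 1 j) j+1≡d)) (+-monoˡ-≤ 4 {1} {4 * 1 + 2 * d} (s≤s z≤n))
spineCost {d} {j} 2 r j+2≡d =
  ≤-trans (spineCost-two r (trans (+-comm 2 j) j+2≡d)) (≤-trans (n≤1+n _) (≤-reflexive (arith d)))
  where
    arith : ∀ d → suc (2 * d + 11) ≡ 4 * 2 + 2 * d + 4
    arith = solve-∀
spineCost {d} {j} (suc (suc (suc k))) zero _ =
  ≤-trans (≤-reflexive (tourCost-leaf d j)) (≤-trans (s≤s z≤n) (m≤n+m 4 (4 * suc (suc (suc k)) + 2 * d)))
spineCost {d} {j} (suc (suc (suc k))) (suc r) j+k+3≡d = begin
  tourCost d j (spine j (suc r))                           ≡⟨ spineCost-step r j≢d ⟩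
  3 + (fanCost d j + tourCost d (suc j) (spine (suc j) r)) ≡⟨ cong (λ a → 3 + (a + tourCost d (suc j) (spine (suc j) r)))
                                                                  (fanCost-back j+2≢d) ⟩
  4 + tourCost d (suc j) (spine (suc j) r)                 ≤⟨ +-monoʳ-≤ 4 (spineCost (suc (suc k)) r
                                                                  (trans (sym (+-suc j (suc (suc k)))) j+k+3≡d)) ⟩
  4 + (4 * suc (suc k) + 2 * d + 4)                        ≡⟨ arith k d ⟩
  4 * suc (suc (suc k)) + 2 * d + 4                        ∎
  where
    open ≤-Reasoning
    j≢d : j ≢ d
    j≢d j≡d = <-irrefl (trans j≡d (sym j+k+3≡d)) (m<m+n j (s≤s z≤n))
    j+2≢d : suc (suc j) ≢ d
    j+2≢d j+2≡d = <-irrefl (trans (trans (+-comm j 2) j+2≡d) (sym j+k+3≡d)) (+-monoʳ-< j (s≤s (s≤s (s≤s z≤n))))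
    arith : ∀ k d → 4 + (4 * suc (suc k) + 2 * d + 4) ≡ 4 * suc (suc (suc k)) + 2 * d + 4
    arith = solve-∀

caterpillarCost : ∀ {d} m → 1 ≤ d → toursCost d 1 (spine 1 m ∷ []) ≤ 8 * d
caterpillarCost {suc d} m _ = begin
  suc (tourCost (suc d) 1 (spine 1 m)) + 0 ≡⟨ +-identityʳ _ ⟩
  suc (tourCost (suc d) 1 (spine 1 m))     ≤⟨ s≤s (spineCost d m refl) ⟩
  suc (4 * d + 2 * suc d + 4)              ≤⟨ m≤n+m _ (2 * d + 1) ⟩
  2 * d + 1 + suc (4 * d + 2 * suc d + 4)  ≡⟨ arith d ⟩
  8 * suc d                                ∎
  where
    open ≤-Reasoning
    arith : ∀ d → 2 * d + 1 + suc (4 * d + 2 * suc d + 4) ≡ 8 * suc d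
    arith = solve-∀

dfs-on-caterpillar : ∀ {d m T} → 1 ≤ d → InP (caterpillar m) T → Σ ℕ λ n → CostLe (dfs d) T d n × n ≤ 8 * d
dfs-on-caterpillar {d} {m} {root cs} d≥1 p =
  toursCost d 1 cs ,
  dfs-reaches-depth d≥1 (AllSafe-↭ d 1 p (Safe-spine d 1 m , tt)) ,
  subst (_≤ 8 * d) (toursCost-↭ d 1 p) (caterpillarCost m d≥1)

ratio⇒cost : ∀ {s m d F d′ T} → InP (caterpillar m) T → 1 ≤ d′ → RatioLe s (caterpillar m) d F (dfs d′) T d′ →
             Σ ℕ λ n → CostLe s (caterpillar m) d n × n ≤ F * 8 * d
ratio⇒cost {d = d} {F} {d′ = suc d″} T∈P d′≥1 ratio
  with n₁ , cost₁ , n₁≤8d′ ← dfs-on-caterpillar d′≥1 T∈P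
  with n₂ , cost₂ , n₂d′≤ ← ratio n₁ cost₁
  = n₂ , cost₂ , *-cancelʳ-≤ n₂ (F * 8 * d) (suc d″) (begin
      n₂ * suc d″           ≤⟨ n₂d′≤ ⟩
      F * n₁ * d            ≤⟨ *-monoˡ-≤ d (*-monoʳ-≤ F n₁≤8d′) ⟩
      F * (8 * suc d″) * d  ≡⟨ arith F d (suc d″) ⟩
      F * 8 * d * suc d″    ∎)
  where
    open ≤-Reasoning
    arith : ∀ F d d′ → F * (8 * d′) * d ≡ F * 8 * d * d′
    arith = solve-∀

-- Counting fan leaves

spinePos : ℕ → Pos
spinePos zero = 0 ∷ []
spinePos (suc k) = 1 ∷ spinePos k

fanLeaf : ℕ → ℕ → Pos
fanLeaf k ℓ = ℓ ∷ 0 ∷ spinePos k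

length-fanLeaf : ∀ k ℓ → length (fanLeaf k ℓ) ≡ 3 + k
length-fanLeaf zero ℓ = refl
length-fanLeaf (suc k) ℓ = cong suc (length-fanLeaf k ℓ)

viewAt-spinePos : ∀ {m} k r → k + r ≡ m → viewAt (caterpillar m) (spinePos k) ≡ just (subV (spine (suc k) r))
viewAt-spinePos zero r refl = refl
viewAt-spinePos {m} (suc k) r e =
  viewAt-∷ {caterpillar m} {spinePos k} {k = 1} (viewAt-spinePos k (suc r) (trans (+-suc k r) e)) refl

IsNode-fanLeaf : ∀ {m k ℓ} → k < m → ℓ < 4 + k → IsNode (caterpillar m) (fanLeaf k ℓ)
IsNode-fanLeaf {m} {k} {ℓ} k<m ℓ< = subst Is-just (sym leafView) (just tt)
  where
    k+r≡m : k + suc (m ∸ suc k) ≡ m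
    k+r≡m = trans (+-suc k (m ∸ suc k)) (m+[n∸m]≡n k<m)
    leafView : viewAt (caterpillar m) (fanLeaf k ℓ) ≡ just (subV leaf)
    leafView = viewAt-∷ {caterpillar m} {0 ∷ spinePos k} {k = ℓ}
                 (viewAt-∷ {caterpillar m} {spinePos k} {k = 0} (viewAt-spinePos k (suc (m ∸ suc k)) k+r≡m) refl)
                 (nth-replicate (4 + k) ℓ<)

fanLeaves : ℕ → List Pos
fanLeaves zero = []
fanLeaves (suc K) = applyUpTo (fanLeaf K) (4 + K) ++ fanLeaves K

∈-fanLeaves⁻ : ∀ K {π} → π ∈ fanLeaves K → Σ ℕ λ k → k < K × Σ ℕ λ ℓ → ℓ < 4 + k × π ≡ fanLeaf k ℓ
∈-fanLeaves⁻ (suc K) π∈ with ∈-++⁻ (applyUpTo (fanLeaf K) (4 + K)) π∈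
... | inj₁ π∈fan = K , ≤-refl , ∈-applyUpTo⁻ (fanLeaf K) π∈fan
... | inj₂ π∈rest with k , k<K , rest ← ∈-fanLeaves⁻ K π∈rest = k , m≤n⇒m≤1+n k<K , rest

fanLeaves-unique : ∀ K → Unique (fanLeaves K)
fanLeaves-unique zero = []
fanLeaves-unique (suc K) =
  Unique.++⁺ (Unique.applyUpTo⁺₁ (fanLeaf K) (4 + K) (λ i<j _ → <⇒≢ i<j ∘ ∷-injectiveˡ))
             (fanLeaves-unique K) disjoint
  where
    disjoint : ∀ {π} → ¬ (π ∈ applyUpTo (fanLeaf K) (4 + K) × π ∈ fanLeaves K)
    disjoint (π∈fan , π∈rest) with ∈-applyUpTo⁻ (fanLeaf K) π∈fan | ∈-fanLeaves⁻ K π∈rest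
    ... | ℓ , _ , refl | k , k<K , ℓ′ , _ , e =
      <-irrefl (trans (sym (length-fanLeaf k ℓ′)) (trans (cong length (sym e)) (length-fanLeaf K ℓ)))
               (s≤s (s≤s (s≤s k<K)))

length-fanLeaves : ∀ K → 2 * length (fanLeaves K) ≡ K * K + 7 * K
length-fanLeaves zero = refl
length-fanLeaves (suc K) = begin
  2 * length (applyUpTo (fanLeaf K) (4 + K) ++ fanLeaves K)           ≡⟨ cong (2 *_) (length-++ (applyUpTo (fanLeaf K) (4 + K))) ⟩
  2 * (length (applyUpTo (fanLeaf K) (4 + K)) + length (fanLeaves K)) ≡⟨ cong (λ n → 2 * (n + length (fanLeaves K)))
                                                                               (length-applyUpTo (fanLeaf K) (4 + K)) ⟩
  2 * (4 + K + length (fanLeaves K))                                  ≡⟨ *-distribˡ-+ 2 (4 + K) _ ⟩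
  2 * (4 + K) + 2 * length (fanLeaves K)                              ≡⟨ cong (2 * (4 + K) +_) (length-fanLeaves K) ⟩
  2 * (4 + K) + (K * K + 7 * K)                                       ≡⟨ arith K ⟩
  suc K * suc K + 7 * suc K                                           ∎
  where
    open ≡-Reasoning
    arith : ∀ K → 2 * (4 + K) + (K * K + 7 * K) ≡ suc K * suc K + 7 * suc K
    arith = solve-∀

step-⊆ : ∀ s T c → visited c ⊆ visited (step s T c)
step-⊆ s T (π , h , W) with move T π (s h)
... | nothing = id
... | just _ = there

length-step : ∀ s T c → length (visited (step s T c)) ≤ suc (length (visited c))
length-step s T (π , h , W) with move T π (s h)
... | nothing = n≤1+n _
... | just _ = ≤-refl

runFor-⊆ : ∀ {s T n N} → n ≤′ N → visited (runFor s T n) ⊆ visited (runFor s T N)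
runFor-⊆ ≤′-refl = id
runFor-⊆ {s} {T} (≤′-step {N} n≤N) = step-⊆ s T (runFor s T N) ∘ runFor-⊆ n≤N

length-visited : ∀ s T n → length (visited (runFor s T n)) ≤ suc n
length-visited s T zero = ≤-refl
length-visited s T (suc n) = ≤-trans (length-step s T (runFor s T n)) (s≤s (length-visited s T n))

too-many-fanLeaves : ∀ {K N L} → 1 ≤ K → 4 * N ≤ (2 + K) * (2 + K) → 2 * L ≡ K * K + 7 * K → ¬ L ≤ suc N
too-many-fanLeaves {suc K} {N} {L} _ 4N≤m² 2L≡ L≤N+1 = <⇒≱ lower upper
  where
    m = 3 + K
    upper : 4 * L ≤ 4 + m * m
    upper = begin
      4 * L      ≤⟨ *-monoʳ-≤ 4 L≤N+1 ⟩
      4 * suc N  ≡⟨ *-suc 4 N ⟩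
      4 + 4 * N  ≤⟨ +-monoʳ-≤ 4 4N≤m² ⟩
      4 + m * m  ∎
      where open ≤-Reasoning
    arith : ∀ K → 4 + (3 + K) * (3 + K) + suc (K * K + 12 * K + 2) ≡ 2 * (suc K * suc K + 7 * suc K)
    arith = solve-∀
    lower : 4 + m * m < 4 * L
    lower = begin-strict
      4 + m * m                             <⟨ m<m+n (4 + m * m) (s≤s z≤n) ⟩
      4 + m * m + suc (K * K + 12 * K + 2)  ≡⟨ arith K ⟩
      2 * (suc K * suc K + 7 * suc K)       ≡⟨ cong (2 *_) (sym 2L≡) ⟩
      2 * (2 * L)                           ≡⟨ sym (*-assoc 2 2 L) ⟩
      4 * L                                 ∎
      where open ≤-Reasoning

Fast : (ℕ → ℕ) → ℕ → (ℕ → Strategy) → Set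
Fast f c S = ∀ m d → Admissible (caterpillar m) d → d ≤ m →
             Σ ℕ λ n → CostLe (S m) (caterpillar m) d n × n ≤ c * f m * 8 * d

fast⇒fanLeaves-visited : ∀ {f c S} → Fast f c S → ∀ K →
  fanLeaves K ⊆ visited (runFor (S (2 + K)) (caterpillar (2 + K)) (c * f (2 + K) * 8 * (2 + K)))
fast⇒fanLeaves-visited {f} {c} {S} fast K π∈
  with k , k<K , ℓ , ℓ< , refl ← ∈-fanLeaves⁻ K π∈
  with isNode ← IsNode-fanLeaf {2 + K} (≤-trans k<K (m≤n+m K 2)) ℓ<
  with depth≤ ← subst (_≤ 2 + K) (sym (length-fanLeaf k ℓ)) (+-monoʳ-≤ 2 k<K)
  with n , cost , n≤ ← fast (2 + K) (length (fanLeaf k ℓ))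
                            (s≤s z≤n , IsNode⇒≤height (fanLeaf k ℓ) isNode) depth≤
  = runFor-⊆ (≤⇒≤′ (≤-trans n≤ (*-monoʳ-≤ (c * f (2 + K) * 8) depth≤))) (cost (fanLeaf k ℓ) isNode refl)

no-fast-explorer : ∀ {f} → LittleO f → ¬ (Σ ℕ λ c → 1 ≤ c × Σ (ℕ → Strategy) (Fast f c))
no-fast-explorer {f} littleO (c , c≥1 , S , fast) =
  too-many-fanLeaves {K} (s≤s z≤n) 4N≤m² (length-fanLeaves K) leaves≤N+1
  where
    bound = littleO (32 * c) (≤-trans c≥1 (m≤n*m c 32))
    K = suc (proj₁ bound)
    m = 2 + K
    4N≤m² : 4 * (c * f m * 8 * m) ≤ m * m
    4N≤m² = begin
      4 * (c * f m * 8 * m)  ≡⟨ arith c (f m) m ⟩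
      32 * c * f m * m       ≤⟨ *-monoˡ-≤ m (proj₂ bound m (m≤n+m (proj₁ bound) 3)) ⟩
      m * m                  ∎
      where
        open ≤-Reasoning
        arith : ∀ c x m → 4 * (c * x * 8 * m) ≡ 32 * c * x * m
        arith = solve-∀
    leaves≤N+1 : length (fanLeaves K) ≤ suc (c * f m * 8 * m)
    leaves≤N+1 = ≤-trans (Unique⇒length≤ (fanLeaves-unique K) (fast⇒fanLeaves-visited {f} {c} {S} fast K))
                         (length-visited (S m) (caterpillar m) _)

penalty⇒fast : ∀ {𝒯₂ 𝒯₁ f} (A₁ : Alg 𝒯₁) (at : ℕ → Index 𝒯₂) →
  (∀ {i T d} → Kn 𝒯₁ i (T , d) → strat A₁ i ≡ dfs d) →
  (∀ {m d} → Admissible (caterpillar m) d → Kn 𝒯₂ (at m) (caterpillar m , d)) →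
  (∀ {m T d} → Kn 𝒯₂ (at m) (T , d) → InP (caterpillar m) T × 1 ≤ d) →
  PenIsO 𝒯₂ 𝒯₁ f → Σ ℕ λ c → 1 ≤ c × Σ (ℕ → Strategy) (Fast f c)
penalty⇒fast {f = f} A₁ at strat≡dfs known relabelled (c , c≥1 , A₂ , pen) = c , c≥1 , S , fast
  where
    S : ℕ → Strategy
    S m = strat A₂ (at m)
    fast : Fast f c S
    fast m d adm d≤m with pen A₁ (at m) m (≤-trans (proj₁ adm) d≤m) (caterpillar m) d (known adm) d≤m
    ... | i₁ , K₁⊆K₂ , T′ , d′ , k₁ , _ , ratio with relabelled (K₁⊆K₂ (T′ , d′) k₁)
    ... | T′∈P , d′≥1 = ratio⇒cost {F = c * f m} T′∈P d′≥1
                          (subst (λ s → RatioLe (S m) (caterpillar m) d (c * f m) s T′ d′) (strat≡dfs k₁) ratio)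

dfsComplete : Alg compDist
dfsComplete = record
  { strat = λ i → dfs (proj₂ (proj₁ i))
  ; inv   = λ i j i≐j h → cong (λ d → dfs d h) (proj₂ (proj₁ i≐j (proj₁ i) (refl , refl)))
  }

dfsBlind : Alg blindDist
dfsBlind = record
  { strat = λ i → dfs (proj₂ (proj₁ i))
  ; inv   = λ i j i≐j h →
              cong (λ d → dfs d h) (proj₂ (proj₁ i≐j (proj₁ i) (InP-refl (proj₁ (proj₁ i)) , refl)))
  }

lemma3p2 : (f : ℕ → ℕ) → LittleO f →
    ¬ (PenIsO compNodist compDist f ⊎ PenIsO blindNodist blindDist f ⊎ PenIsO blindNodist compDist f)
lemma3p2 f littleO (inj₁ pen) =
  no-fast-explorer littleO (penalty⇒fast dfsComplete caterpillar (cong dfs ∘ sym ∘ proj₂) (refl ,_)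
                                         (λ { (refl , adm) → InP-refl _ , proj₁ adm }) pen)
lemma3p2 f littleO (inj₂ (inj₁ pen)) =
  no-fast-explorer littleO (penalty⇒fast dfsBlind caterpillar (cong dfs ∘ sym ∘ proj₂) (InP-refl _ ,_)
                                         (λ (T∈P , adm) → T∈P , proj₁ adm) pen)
lemma3p2 f littleO (inj₂ (inj₂ pen)) =
  no-fast-explorer littleO (penalty⇒fast dfsComplete caterpillar (cong dfs ∘ sym ∘ proj₂) (InP-refl _ ,_)
                                         (λ (T∈P , adm) → T∈P , proj₁ adm) pen)
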